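{- Let $\Sigma,\Gamma$ be finite alphabets, $w\in\Sigma^+$, $h:\Sigma^*\to\Gamma^*$ an injective morphism, and suppose $h(w)=x^r$ where $x\in\Gamma^+$ has minimal length among words with this property and $r\in\mathbb{Q}$. If $|h(a)|\ge|x|$ for some letter $a\in\Sigma$, and $ava$ and $aua$ are factors of $w$ for some words $u,v\in(\Sigma\setminus\{a\})^*$, then $u=v$.
   Context: For a nonempty word $v$ and rational $r\ge0$ with $r|v|\in\mathbb{N}$, $v^r$ denotes the prefix of length $r|v|$ of the infinite word $vvv\cdots$. -}

module Defs where

open import Data.Nat using (ℕ; suc; _≤_; _<_)
open import Data.Fin using (Fin)
open import Data.List using (List; []; _∷_; _++_; length; take; concat; replicate; concatMap; [_])
open import Data.List.Membership.Propositional using (_∉_)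
open import Data.Product using (Σ; ∃; ∃-syntax; _×_; _,_)
open import Data.Rational using (ℚ; _*_; 0ℚ) renaming (_≤_ to _≤ℚ_)
import Data.Rational as ℚ
open import Data.Integer using (+_)
open import Relation.Binary.PropositionalEquality using (_≡_)
open import Function.Definitions using (Injective)

Word : Set → Set
Word A = List A

NonEmpty : {A : Set} → Word A → Set
NonEmpty x = 1 ≤ length x

extend : {A B : Set} → (A → Word B) → Word A → Word B
extend f = concatMap f

InjectiveMorphism : {A B : Set} → (A → Word B) → Set
InjectiveMorphism f = Injective _≡_ _≡_ (extend f)

-- Prefix of length n of the infinite word x x x ⋯ (for nonempty x,
-- n copies of x already have length ≥ n).
prefixPow : {A : Set} → Word A → ℕ → Word A
prefixPow x n = take n (concat (replicate (suc n) x))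

-- y = x^r, for rational r ≥ 0 with r·|x| ∈ ℕ : y is the prefix of length r|x| of x^ω.
IsPowerWith : {A : Set} → Word A → Word A → ℚ → Set
IsPowerWith y x r =
  (0ℚ ≤ℚ r) × Σ ℕ (λ n → (r * ((+ length x) ℚ./ 1) ≡ ((+ n) ℚ./ 1)) × (y ≡ prefixPow x n))

Factor : {A : Set} → Word A → Word A → Set
Factor u w = ∃[ p ] ∃[ s ] (w ≡ p ++ u ++ s)

Avoids : {A : Set} → A → Word A → Set
Avoids a u = a ∉ u

-- Write Z = h(w), a prefix of the infinite word x^ω, which has period p = |x|. An
-- occurrence of a y a in w puts two copies of h(a), of length ≥ p, at distance
-- |h(a y)| in Z; since a p-periodic word is determined by any p consecutive letters,
-- the suffix of x^ω starting at such an occurrence has period |h(a y)| and begins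
-- with h(a y). For y = u and y = v both suffixes begin with h(a), so they coincide,
-- and h(a u) and h(a v) are then two periods of the same word whose prefixes they are;
-- hence h(a u a v) = h(a v a u). By injectivity a u a v = a v a u, so u = v as neither contains a.
module Submission where

open import Defs
open import Data.Nat using (ℕ; _≤_)
open import Data.Fin using (Fin)
open import Data.List using (List; _∷_; _++_; [_]; length)
open import Data.Product using (_×_)
open import Data.Rational using (ℚ)
open import Relation.Binary.PropositionalEquality using (_≡_)

open import Function using (_∘_)
open import Data.Nat using (zero; suc; _+_; _*_; _<_; _%_; _/_; NonZero; s≤s)
open import Data.Nat.Properties using (+-assoc; +-comm; +-identityʳ; <-≤-trans; suc-injective)
open import Data.Nat.DivMod using (_mod_; m≡m%n+[m/n]*n; [m+n]%n≡m%n; m%n<n; m<n⇒m%n≡m)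
open import Data.Fin using (toℕ; zero; suc)
open import Data.Fin.Properties using (toℕ<n; fromℕ<-cong; fromℕ<-toℕ)
open import Data.List using ([]; take; concat; replicate; lookup)
open import Data.List.Properties using (++-assoc; length-++; concatMap-++; ∷-injective; ∷-injectiveʳ)
open import Data.List.Relation.Unary.Any using (here; there)
open import Data.Product using (_,_; proj₁; proj₂; ∃-syntax)
open import Data.Empty using (⊥-elim)
open import Relation.Binary.PropositionalEquality
  using (refl; sym; trans; cong; cong₂; subst; _≗_; module ≡-Reasoning)

private variable
  A B : Set

Periodic : ℕ → (ℕ → A) → Set
Periodic p f = ∀ t → f (t + p) ≡ f t

infix 4 _IsPrefixOf_

data _IsPrefixOf_ {A : Set} : List A → (ℕ → A) → Set where
  []  : ∀ {f} → [] IsPrefixOf f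
  _∷_ : ∀ {c G f} → f 0 ≡ c → G IsPrefixOf (f ∘ suc) → (c ∷ G) IsPrefixOf f

cycle : (x : List A) .{{_ : NonZero (length x)}} → ℕ → A
cycle x t = lookup x (t mod length x)

periodic-shift : ∀ {p} {f : ℕ → A} (i : ℕ) → Periodic p f → Periodic p (f ∘ (i +_))
periodic-shift {p = p} {f} i f-per t = trans (cong f (sym (+-assoc i t p))) (f-per (i + t))

periodic-* : ∀ {p} {f : ℕ → A} → Periodic p f → ∀ t c → f (t + c * p) ≡ f t
periodic-* {f = f} f-per t zero = cong f (+-identityʳ t)
periodic-* {p = p} {f} f-per t (suc c) =
  trans (cong f (sym (+-assoc t p (c * p)))) (trans (periodic-* f-per (t + p) c) (f-per t))

periodic-≗ : ∀ {p} .{{_ : NonZero p}} {f g : ℕ → A} → Periodic p f → Periodic p g →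
  (∀ t → t < p → f t ≡ g t) → f ≗ g
periodic-≗ {p = p} {f} {g} f-per g-per agree t = begin
  f t                     ≡⟨ cong f (m≡m%n+[m/n]*n t p) ⟩
  f (t % p + (t / p) * p) ≡⟨ periodic-* f-per (t % p) (t / p) ⟩
  f (t % p)               ≡⟨ agree (t % p) (m%n<n t p) ⟩
  g (t % p)               ≡⟨ periodic-* g-per (t % p) (t / p) ⟨
  g (t % p + (t / p) * p) ≡⟨ cong g (m≡m%n+[m/n]*n t p) ⟨
  g t                     ∎
  where open ≡-Reasoning

prefix-resp-≗ : ∀ {G} {f g : ℕ → A} → f ≗ g → G IsPrefixOf f → G IsPrefixOf g
prefix-resp-≗ f≗g []           = []
prefix-resp-≗ f≗g (f0≡c ∷ G≺f) = trans (sym (f≗g 0)) f0≡c ∷ prefix-resp-≗ (f≗g ∘ suc) G≺f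

prefix-agree : ∀ {G} {f g : ℕ → A} → G IsPrefixOf f → G IsPrefixOf g →
  ∀ t → t < length G → f t ≡ g t
prefix-agree (f0≡c ∷ _) (g0≡c ∷ _) zero _ = trans f0≡c (sym g0≡c)
prefix-agree (_ ∷ G≺f) (_ ∷ G≺g) (suc t) (s≤s t<G) = prefix-agree G≺f G≺g t t<G

prefix-unique : ∀ {G G′} {f : ℕ → A} → length G ≡ length G′ →
  G IsPrefixOf f → G′ IsPrefixOf f → G ≡ G′
prefix-unique _ [] [] = refl
prefix-unique |G|≡|G′| (f0≡c ∷ G≺f) (f0≡c′ ∷ G′≺f) =
  cong₂ _∷_ (trans (sym f0≡c) f0≡c′) (prefix-unique (suc-injective |G|≡|G′|) G≺f G′≺f)

prefix-++⁺ : ∀ {G₁ G₂} {f : ℕ → A} → G₁ IsPrefixOf f → G₂ IsPrefixOf (f ∘ (length G₁ +_)) →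
  (G₁ ++ G₂) IsPrefixOf f
prefix-++⁺ []           G₂≺f = G₂≺f
prefix-++⁺ (f0≡c ∷ G₁≺f) G₂≺f = f0≡c ∷ prefix-++⁺ G₁≺f G₂≺f

prefix-++⁻ : ∀ G₁ {G₂} {f : ℕ → A} → (G₁ ++ G₂) IsPrefixOf f →
  G₁ IsPrefixOf f × G₂ IsPrefixOf (f ∘ (length G₁ +_))
prefix-++⁻ []       G≺f            = [] , G≺f
prefix-++⁻ (_ ∷ G₁) (f0≡c ∷ G≺f) with prefix-++⁻ G₁ G≺f
... | G₁≺f , G₂≺f = f0≡c ∷ G₁≺f , G₂≺f

prefix-periodic-++ : ∀ {G₁ G₂} {f : ℕ → A} → G₁ IsPrefixOf f → Periodic (length G₁) f →
  G₂ IsPrefixOf f → (G₁ ++ G₂) IsPrefixOf f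
prefix-periodic-++ {G₁ = G₁} {f = f} G₁≺f f-per G₂≺f = prefix-++⁺ G₁≺f (prefix-resp-≗ shift G₂≺f)
  where
  shift : f ≗ f ∘ (length G₁ +_)
  shift t = sym (trans (cong f (+-comm (length G₁) t)) (f-per t))

-- G₁ G₂ and G₂ G₁ are prefixes of the same length of f.
periods-commute : ∀ {G₁ G₂} {f : ℕ → A} →
  G₁ IsPrefixOf f → Periodic (length G₁) f → G₂ IsPrefixOf f → Periodic (length G₂) f →
  G₁ ++ G₂ ≡ G₂ ++ G₁
periods-commute {G₁ = G₁} {G₂} G₁≺f f-per₁ G₂≺f f-per₂ =
  prefix-unique |G₁G₂|≡|G₂G₁| (prefix-periodic-++ G₁≺f f-per₁ G₂≺f) (prefix-periodic-++ G₂≺f f-per₂ G₁≺f)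
  where
  |G₁G₂|≡|G₂G₁| : length (G₁ ++ G₂) ≡ length (G₂ ++ G₁)
  |G₁G₂|≡|G₂G₁| = trans (length-++ G₁) (trans (+-comm (length G₁) _) (sym (length-++ G₂)))

prefix-take : ∀ {G} {f : ℕ → A} n → G IsPrefixOf f → take n G IsPrefixOf f
prefix-take zero    _            = []
prefix-take (suc n) []           = []
prefix-take (suc n) (f0≡c ∷ G≺f) = f0≡c ∷ prefix-take n G≺f

prefix-concat-replicate : ∀ {G} {f : ℕ → A} → G IsPrefixOf f → Periodic (length G) f →
  ∀ m → concat (replicate m G) IsPrefixOf f
prefix-concat-replicate G≺f f-per zero    = []
prefix-concat-replicate G≺f f-per (suc m) =
  prefix-periodic-++ G≺f f-per (prefix-concat-replicate G≺f f-per m)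

prefix-lookup : ∀ {G} {f : ℕ → A} → (∀ i → f (toℕ i) ≡ lookup G i) → G IsPrefixOf f
prefix-lookup {G = []}    _    = []
prefix-lookup {G = _ ∷ G} f≡G! = f≡G! zero ∷ prefix-lookup (f≡G! ∘ suc)

cycle-periodic : (x : List A) .{{_ : NonZero (length x)}} → Periodic (length x) (cycle x)
cycle-periodic x t =
  cong (lookup x) (fromℕ<-cong _ _ ([m+n]%n≡m%n t (length x)) (m%n<n _ _) (m%n<n _ _))

prefix-cycle : (x : List A) .{{_ : NonZero (length x)}} → x IsPrefixOf cycle x
prefix-cycle x = prefix-lookup λ i → cong (lookup x)
  (trans (fromℕ<-cong _ _ (m<n⇒m%n≡m (toℕ<n i)) (m%n<n _ _) (toℕ<n i)) (fromℕ<-toℕ i (toℕ<n i)))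

prefixPow-prefix-cycle : (x : List A) .{{_ : NonZero (length x)}} →
  ∀ n → prefixPow x n IsPrefixOf cycle x
prefixPow-prefix-cycle x n =
  prefix-take n (prefix-concat-replicate (prefix-cycle x) (cycle-periodic x) (suc n))

periodic-resp-≗ : ∀ {p} {f g : ℕ → A} → f ≗ g → Periodic p f → Periodic p g
periodic-resp-≗ {p = p} f≗g f-per t = trans (sym (f≗g (t + p))) (trans (f-per t) (f≗g t))

periodic-prefix-≗ : ∀ {p} .{{_ : NonZero p}} {H} {f g : ℕ → A} → Periodic p f → Periodic p g →
  H IsPrefixOf f → H IsPrefixOf g → p ≤ length H → f ≗ g
periodic-prefix-≗ f-per g-per H≺f H≺g p≤|H| =
  periodic-≗ f-per g-per (λ t t<p → prefix-agree H≺f H≺g t (<-≤-trans t<p p≤|H|))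

-- Both occurrences of H see the same p-periodic word, so shifting by |H Y| changes nothing.
bordered-prefix-periodic : ∀ {p} .{{_ : NonZero p}} {H Y S} {f : ℕ → A} →
  Periodic p f → p ≤ length H →
  (H ++ Y) IsPrefixOf f → (H ++ S) IsPrefixOf (f ∘ (length (H ++ Y) +_)) →
  Periodic (length (H ++ Y)) f
bordered-prefix-periodic {H = H} {Y} {f = f} f-per p≤|H| HY≺f HS≺f t = begin
  f (t + length (H ++ Y)) ≡⟨ cong f (+-comm t _) ⟩
  f (length (H ++ Y) + t) ≡⟨ f≗shifted t ⟨
  f t                     ∎
  where
  open ≡-Reasoning
  f≗shifted : f ≗ f ∘ (length (H ++ Y) +_)
  f≗shifted = periodic-prefix-≗ f-per (periodic-shift _ f-per)
    (proj₁ (prefix-++⁻ H HY≺f)) (proj₁ (prefix-++⁻ H HS≺f)) p≤|H|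

extend-factor : (h : A → Word B) {w pre suf : Word A} {a : A} {y : Word A} →
  w ≡ pre ++ (a ∷ y ++ [ a ]) ++ suf →
  extend h w ≡ extend h pre ++ (h a ++ extend h y) ++ (h a ++ extend h suf)
extend-factor h {pre = pre} {suf} {a} {y} refl = begin
  extend h (pre ++ (a ∷ y ++ [ a ]) ++ suf)         ≡⟨ cong (extend h ∘ (pre ++_)) (++-assoc (a ∷ y) [ a ] suf) ⟩
  extend h (pre ++ (a ∷ y) ++ (a ∷ suf))            ≡⟨ concatMap-++ h pre _ ⟩
  extend h pre ++ extend h ((a ∷ y) ++ (a ∷ suf))   ≡⟨ cong (extend h pre ++_) (concatMap-++ h (a ∷ y) (a ∷ suf)) ⟩
  extend h pre ++ extend h (a ∷ y) ++ extend h (a ∷ suf) ∎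
  where open ≡-Reasoning

factor-periodic : ∀ {p} .{{_ : NonZero p}} {f : ℕ → B} (h : A → Word B) {w : Word A} {a y} →
  Periodic p f → extend h w IsPrefixOf f → p ≤ length (h a) → Factor (a ∷ y ++ [ a ]) w →
  ∃[ i ] (h a ++ extend h y) IsPrefixOf (f ∘ (i +_))
       × Periodic (length (h a ++ extend h y)) (f ∘ (i +_))
factor-periodic {f = f} h {a = a} {y} f-per hw≺f p≤|ha| (pre , suf , w≡) =
  i , HY≺g , bordered-prefix-periodic {H = h a} (periodic-shift i f-per) p≤|ha| HY≺g HS≺g
  where
  i : ℕ
  i = length (extend h pre)
  rest≺g : ((h a ++ extend h y) ++ (h a ++ extend h suf)) IsPrefixOf (f ∘ (i +_))
  rest≺g = proj₂ (prefix-++⁻ (extend h pre) (subst (_IsPrefixOf _) (extend-factor h {suf = suf} {y = y} w≡) hw≺f))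
  HY≺g : (h a ++ extend h y) IsPrefixOf (f ∘ (i +_))
  HY≺g = proj₁ (prefix-++⁻ (h a ++ extend h y) rest≺g)
  HS≺g : (h a ++ extend h suf) IsPrefixOf (f ∘ (i +_) ∘ (length (h a ++ extend h y) +_))
  HS≺g = proj₂ (prefix-++⁻ (h a ++ extend h y) rest≺g)

prefix-before-unique : ∀ {a : A} {u v X Y} → Avoids a u → Avoids a v → u ++ a ∷ X ≡ v ++ a ∷ Y → u ≡ v
prefix-before-unique {u = []}    {[]}    _   _   _  = refl
prefix-before-unique {u = []}    {_ ∷ _} _   a∉v eq = ⊥-elim (a∉v (here (proj₁ (∷-injective eq))))
prefix-before-unique {u = _ ∷ _} {[]}    a∉u _   eq = ⊥-elim (a∉u (here (sym (proj₁ (∷-injective eq)))))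
prefix-before-unique {u = _ ∷ _} {_ ∷ _} a∉u a∉v eq with ∷-injective eq
... | refl , eq′ = cong (_ ∷_) (prefix-before-unique (a∉u ∘ there) (a∉v ∘ there) eq′)

mainTheorem14 : (m k : ℕ) (h : Fin m → Word (Fin k)) (w : Word (Fin m))
    (x : Word (Fin k)) (r : ℚ) →
    NonEmpty w → InjectiveMorphism h →
    NonEmpty x → IsPowerWith (extend h w) x r →
    ((y : Word (Fin k)) (s : ℚ) → NonEmpty y → IsPowerWith (extend h w) y s → length x ≤ length y) →
    (a : Fin m) → length x ≤ length (h a) →
    (u v : Word (Fin m)) → Avoids a u → Avoids a v →
    Factor (a ∷ v ++ [ a ]) w → Factor (a ∷ u ++ [ a ]) w →
    u ≡ v
mainTheorem14 m k h w (c ∷ x′) r _ h-inj _ (_ , n , _ , hw≡xⁿ) _ a |x|≤|ha| u v a∉u a∉v ava aua =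
  prefix-before-unique a∉u a∉v (∷-injectiveʳ (h-inj h[auav]≡h[avau]))
  where
  x = c ∷ x′
  hw≺xω : extend h w IsPrefixOf cycle x
  hw≺xω = subst (_IsPrefixOf cycle x) (sym hw≡xⁿ) (prefixPow-prefix-cycle x n)
  commute : extend h (a ∷ u) ++ extend h (a ∷ v) ≡ extend h (a ∷ v) ++ extend h (a ∷ u)
  commute with factor-periodic h (cycle-periodic x) hw≺xω |x|≤|ha| aua
             | factor-periodic h (cycle-periodic x) hw≺xω |x|≤|ha| ava
  ... | i , hau≺ , i-per | j , hav≺ , j-per =
    periods-commute hau≺ i-per (prefix-resp-≗ j≗i hav≺) (periodic-resp-≗ j≗i j-per)
    where
    j≗i : cycle x ∘ (j +_) ≗ cycle x ∘ (i +_)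
    j≗i = periodic-prefix-≗ (periodic-shift j (cycle-periodic x)) (periodic-shift i (cycle-periodic x))
      (proj₁ (prefix-++⁻ (h a) hav≺)) (proj₁ (prefix-++⁻ (h a) hau≺)) |x|≤|ha|
  h[auav]≡h[avau] : extend h ((a ∷ u) ++ (a ∷ v)) ≡ extend h ((a ∷ v) ++ (a ∷ u))
  h[auav]≡h[avau] =
    trans (concatMap-++ h (a ∷ u) (a ∷ v)) (trans commute (sym (concatMap-++ h (a ∷ v) (a ∷ u))))
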